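{- Let $\sigma\ge1$ and let $T\in[0..\sigma)^n$ be nonempty. Let $T'=\Big(\bigodot_{i=1}^{n}\big(0\,0\,1\,(\sigma-1-T[i])\,1\big)\Big)\cdot 1$ (a string of integers). Then: (1) for every $j\in[1..n]\setminus\{\mathrm{SA}_T[1]\}$, $\Phi_T[j]=\tfrac15\big(\Phi^{ -1}_{T'}[1+5(j-1)]-1\big)+1$; (2) for every $j\in[1..n]\setminus\{\mathrm{SA}_T[n]\}$, $\Phi^{ -1}_T[j]=\tfrac15\big(\Phi_{T'}[1+5(j-1)]-1\big)+1$.
   Context: Strings over integers with their usual order; lexicographic order: a proper prefix is smaller, otherwise compare at first difference. For a string $S$ of length $N$, $\mathrm{SA}_S$ lists its suffix starting positions in increasing lexicographic order. $\Phi_S$ is the array with $\Phi_S[\mathrm{SA}_S[i]]=\mathrm{SA}_S[i-1]$ for $i\in(1..N]$ and $\Phi_S[\mathrm{SA}_S[1]]=\mathrm{SA}_S[N]$; $\Phi^{ -1}_S$ is its inverse permutation, i.e., $\Phi^{ -1}_S[\mathrm{SA}_S[i]]=\mathrm{SA}_S[i+1]$ for $i\in[1..N)$ and $\Phi^{ -1}_S[\mathrm{SA}_S[N]]=\mathrm{SA}_S[1]$. -}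

module Defs where

open import Data.Nat using (ℕ; zero; suc; _+_; _*_; _∸_; _<_; _≟_; _<?_)
open import Data.List using (List; []; _∷_; length; drop; filter; map; upTo; _++_; concatMap)
open import Data.Product using (_×_; _,_)
open import Data.Sum using (_⊎_; inj₁; inj₂)
open import Relation.Nullary using (Dec; yes; no; ¬_)
open import Relation.Binary.PropositionalEquality using (_≡_; refl)
open import Data.Empty using (⊥)

-- Strings are lists of natural numbers; positions are 1-based.

data _<lex_ : List ℕ → List ℕ → Set where
  []<∷  : ∀ {y ys} → [] <lex (y ∷ ys)
  head< : ∀ {x y xs ys} → x < y → (x ∷ xs) <lex (y ∷ ys)
  tail< : ∀ {x xs ys} → xs <lex ys → (x ∷ xs) <lex (x ∷ ys)

_<lex?_ : (xs ys : List ℕ) → Dec (xs <lex ys)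
[] <lex? [] = no (λ ())
[] <lex? (y ∷ ys) = yes []<∷
(x ∷ xs) <lex? [] = no (λ ())
(x ∷ xs) <lex? (y ∷ ys) with x <? y
... | yes x<y = yes (head< x<y)
... | no x≮y with x ≟ y
...   | no x≢y = no λ { (head< p) → x≮y p ; (tail< _) → x≢y refl }
...   | yes refl with xs <lex? ys
...     | yes p = yes (tail< p)
...     | no ¬p = no λ { (head< p) → x≮y p ; (tail< p) → ¬p p }

suf : List ℕ → ℕ → List ℕ
suf S i = drop (i ∸ 1) S

positions : List ℕ → List ℕ
positions S = map suc (upTo (length S))

-- rank of suffix i: 1 + number of suffixes of S lexicographically smaller
-- (i.e. the inverse suffix array ISA_S[i], so SA_S[rank S i] = i)
rank : List ℕ → ℕ → ℕ
rank S i = suc (length (filter (λ j → suf S j <lex? suf S i) (positions S)))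

findRank : List ℕ → ℕ → List ℕ → ℕ
findRank S r [] = 0
findRank S r (j ∷ js) with rank S j ≟ r
... | yes _ = j
... | no _  = findRank S r js

SA : List ℕ → ℕ → ℕ
SA S r = findRank S r (positions S)

Φ : List ℕ → ℕ → ℕ
Φ S j with rank S j ≟ 1
... | yes _ = SA S (length S)
... | no _  = SA S (rank S j ∸ 1)

Φinv : List ℕ → ℕ → ℕ
Φinv S j with rank S j ≟ length S
... | yes _ = SA S 1
... | no _  = SA S (suc (rank S j))

transform : ℕ → List ℕ → List ℕ
transform σ T = concatMap (λ c → 0 ∷ 0 ∷ 1 ∷ (σ ∸ 1 ∸ c) ∷ 1 ∷ []) T ++ (1 ∷ [])

{-# OPTIONS --safe #-}
-- Each letter c of T becomes the block 0 0 1 (σ-1-c) 1 of T'.  A suffix of T' starting inside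
-- a block, or at the final 1, begins with 0 1, 1 or y 1, so it exceeds every block-start suffix
-- 0 0 …; and complementing the letters makes block-start suffixes compare in the opposite order
-- to the corresponding suffixes of T.  Hence the block starts take the ranks 1..n of T' in
-- reverse, rank_T'(block j) = n + 1 - rank_T(j), so the SA_T-predecessor of j gives the
-- SA_T'-successor of block j, and vice versa.
module Submission where

open import Defs
open import Data.Nat using (ℕ; zero; suc; _+_; _*_; _∸_; _<_; _≤_; z≤n; s≤s; s≤s⁻¹; z<s; _≟_)
open import Data.Nat.Properties
open import Data.List using (List; []; _∷_; length; drop; filter; map; upTo; applyUpTo; _++_)
open import Data.List.Properties using (filter-accept; filter-reject; length-filter; length-drop; map-∘; map-upTo)
open import Data.List.Membership.Propositional using (_∈_)
open import Data.List.Membership.Propositional.Properties using (∈-map⁺; ∈-map⁻; ∈-upTo⁺; ∈-upTo⁻)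
open import Data.List.Relation.Unary.Any using (here; there)
open import Data.List.Relation.Unary.All as All using (All; []; _∷_)
open import Data.List.Relation.Unary.All.Properties using (drop⁺)
open import Data.List.Relation.Unary.Unique.Propositional using (Unique; []; _∷_)
open import Data.List.Relation.Binary.Sublist.Propositional using (_⊆_; ⊆-refl; _∷ʳ_)
open import Data.List.Relation.Binary.Sublist.Propositional.Properties using (filter⁺; length-mono-≤)
open import Data.Product using (_×_; _,_; ∃-syntax)
open import Data.Sum using (_⊎_; inj₁; inj₂)
open import Function using (_∘_; id)
open import Level using (0ℓ)
open import Relation.Nullary using (Dec; yes; no; ¬_; contradiction)
open import Relation.Unary using (Pred; Decidable)
open import Relation.Binary using (Rel; Transitive; tri<; tri≈; tri>)
open import Relation.Binary.PropositionalEquality using (_≡_; _≢_; refl; sym; trans; cong; cong₂; subst; ≢-sym; module ≡-Reasoning)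

length-filter-map : ∀ {A B : Set} {P : Pred B 0ℓ} (P? : Decidable P) (f : A → B) xs →
  length (filter (P? ∘ f) xs) ≡ length (filter P? (map f xs))
length-filter-map P? f []       = refl
length-filter-map P? f (x ∷ xs) with P? (f x)
... | yes _ = cong suc (length-filter-map P? f xs)
... | no _  = length-filter-map P? f xs

module Ranking {A : Set} {_≺_ : Rel A 0ℓ} (_≺?_ : ∀ a b → Dec (a ≺ b))
  (≺-irrefl : ∀ {a} → ¬ a ≺ a) (≺-trans : Transitive _≺_)
  (≺-compare : ∀ a b → a ≺ b ⊎ a ≡ b ⊎ b ≺ a) where

  below above : A → List A → ℕ
  below a xs = length (filter (_≺? a) xs)
  above a xs = length (filter (a ≺?_) xs)

  private variable
    a b x y : A
    xs ys : List A

  ≺-asym : a ≺ b → ¬ b ≺ a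
  ≺-asym a≺b b≺a = ≺-irrefl (≺-trans a≺b b≺a)

  below-accept : x ≺ a → below a (x ∷ xs) ≡ suc (below a xs)
  below-accept x≺a = cong length (filter-accept (_≺? _) x≺a)

  below-reject : ¬ x ≺ a → below a (x ∷ xs) ≡ below a xs
  below-reject x⊀a = cong length (filter-reject (_≺? _) x⊀a)

  above-accept : a ≺ x → above a (x ∷ xs) ≡ suc (above a xs)
  above-accept a≺x = cong length (filter-accept (_ ≺?_) a≺x)

  above-reject : ¬ a ≺ x → above a (x ∷ xs) ≡ above a xs
  above-reject a⊀x = cong length (filter-reject (_ ≺?_) a⊀x)

  below-mono : (∀ {x} → x ≺ a → x ≺ b) → xs ⊆ ys → below a xs ≤ below b ys
  below-mono ≺a⇒≺b xs⊆ys = length-mono-≤ (filter⁺ (_≺? _) (_≺? _) (λ { refl → ≺a⇒≺b }) xs⊆ys)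

  below-strict : a ∈ xs → a ≺ b → below a xs < below b xs
  below-strict {a} {b = b} (here {xs = xs} refl) a≺b = begin-strict
    below a (a ∷ xs)  ≡⟨ below-reject ≺-irrefl ⟩
    below a xs        ≤⟨ below-mono {xs = xs} (λ x≺a → ≺-trans x≺a a≺b) ⊆-refl ⟩
    below b xs        <⟨ n<1+n _ ⟩
    suc (below b xs)  ≡⟨ below-accept a≺b ⟨
    below b (a ∷ xs)  ∎
    where open ≤-Reasoning
  below-strict {a} {b = b} (there {x = x} {xs = xs} a∈) a≺b with x ≺? a
  ... | yes x≺a = begin-strict
    suc (below a xs)  <⟨ s≤s (below-strict a∈ a≺b) ⟩
    suc (below b xs)  ≡⟨ below-accept (≺-trans x≺a a≺b) ⟨
    below b (x ∷ xs)  ∎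
    where open ≤-Reasoning
  ... | no _ = begin-strict
    below a xs        <⟨ below-strict a∈ a≺b ⟩
    below b xs        ≤⟨ below-mono id (x ∷ʳ ⊆-refl) ⟩
    below b (x ∷ xs)  ∎
    where open ≤-Reasoning

  below-injective : a ∈ xs → b ∈ xs → below a xs ≡ below b xs → a ≡ b
  below-injective {a} {b = b} a∈ b∈ eq with ≺-compare a b
  ... | inj₁ a≺b        = contradiction eq (<⇒≢ (below-strict a∈ a≺b))
  ... | inj₂ (inj₁ a≡b) = a≡b
  ... | inj₂ (inj₂ b≺a) = contradiction (sym eq) (<⇒≢ (below-strict b∈ b≺a))

  below-surjective : Unique xs → ∀ {r} → r < length xs → ∃[ b ] b ∈ xs × below b xs ≡ r
  below-surjective {x ∷ xs} (x∉xs ∷ xs!) {r} r<1+n with <-cmp r (below x xs)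
  ... | tri≈ _ r≡q _ = x , here refl , trans (below-reject ≺-irrefl) (sym r≡q)
  ... | tri< r<q _ _
    with b , b∈ , b≡r ← below-surjective xs! (<-≤-trans r<q (length-filter (_≺? x) xs))
    = b , there b∈ , trans (below-reject x⊀b) b≡r
    where
    x⊀b : ¬ x ≺ b
    x⊀b x≺b = <⇒≱ r<q (subst (below x xs ≤_) b≡r (below-mono {xs = xs} (λ y≺x → ≺-trans y≺x x≺b) ⊆-refl))
  ... | tri> _ _ (s≤s q≤r)
    with b , b∈ , b≡r ← below-surjective xs! (s≤s⁻¹ r<1+n)
    = b , there b∈ , trans (below-accept x≺b) (cong suc b≡r)
    where
    x≺b : x ≺ b
    x≺b with ≺-compare x b
    ... | inj₁ x≺b        = x≺b
    ... | inj₂ (inj₁ x≡b) = contradiction x≡b (All.lookup x∉xs b∈)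
    ... | inj₂ (inj₂ b≺x) = contradiction (subst (_< below x xs) b≡r (below-strict b∈ b≺x)) (≤⇒≯ q≤r)

  below-+-above-∷ : x ≢ a → below a (x ∷ xs) + above a (x ∷ xs) ≡ suc (below a xs + above a xs)
  below-+-above-∷ {x} {a} x≢a with ≺-compare x a
  ... | inj₁ x≺a        = cong₂ _+_ (below-accept x≺a) (above-reject (≺-asym x≺a))
  ... | inj₂ (inj₁ x≡a) = contradiction x≡a x≢a
  ... | inj₂ (inj₂ a≺x) = trans (cong₂ _+_ (below-reject (≺-asym a≺x)) (above-accept a≺x)) (+-suc _ _)

  below-+-above-∉ : All (_≢ a) xs → below a xs + above a xs ≡ length xs
  below-+-above-∉ []             = refl
  below-+-above-∉ (x≢a ∷ xs≢a) = trans (below-+-above-∷ x≢a) (cong suc (below-+-above-∉ xs≢a))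

  below-+-above : Unique xs → a ∈ xs → suc (below a xs + above a xs) ≡ length xs
  below-+-above {a ∷ xs} {a} (a∉xs ∷ _) (here refl) = cong suc (begin
    below a (a ∷ xs) + above a (a ∷ xs)  ≡⟨ cong₂ _+_ (below-reject ≺-irrefl) (above-reject ≺-irrefl) ⟩
    below a xs + above a xs              ≡⟨ below-+-above-∉ (All.map ≢-sym a∉xs) ⟩
    length xs                            ∎)
    where open ≡-Reasoning
  below-+-above (x∉xs ∷ xs!) (there a∈) =
    cong suc (trans (below-+-above-∷ (All.lookup x∉xs a∈)) (below-+-above xs! a∈))

  below-∷≡above-∷ : (x ≺ a → b ≺ y) → (b ≺ y → x ≺ a) → below a xs ≡ above b ys →
    below a (x ∷ xs) ≡ above b (y ∷ ys)
  below-∷≡above-∷ {x} {a} {b} {y} to from eq with x ≺? a | b ≺? y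
  ... | yes _   | yes _   = cong suc eq
  ... | no _    | no _    = eq
  ... | yes x≺a | no b⊀y = contradiction (to x≺a) b⊀y
  ... | no x⊀a | yes b≺y = contradiction (from b≺y) x⊀a

  below-++ : All (λ y → ¬ y ≺ a) ys → below a (ys ++ xs) ≡ below a xs
  below-++ []             = refl
  below-++ (y⊀a ∷ ys⊀a) = trans (below-reject y⊀a) (below-++ ys⊀a)

<lex-irrefl : ∀ {xs} → ¬ xs <lex xs
<lex-irrefl (head< x<x)   = <-irrefl refl x<x
<lex-irrefl (tail< xs<xs) = <lex-irrefl xs<xs

<lex-trans : Transitive _<lex_
<lex-trans []<∷      (head< _)  = []<∷
<lex-trans []<∷      (tail< _)  = []<∷
<lex-trans (head< p) (head< q) = head< (<-trans p q)
<lex-trans (head< p) (tail< _) = head< p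
<lex-trans (tail< _) (head< q) = head< q
<lex-trans (tail< p) (tail< q) = tail< (<lex-trans p q)

<lex-compare : ∀ xs ys → xs <lex ys ⊎ xs ≡ ys ⊎ ys <lex xs
<lex-compare []       []       = inj₂ (inj₁ refl)
<lex-compare []       (y ∷ ys) = inj₁ []<∷
<lex-compare (x ∷ xs) []       = inj₂ (inj₂ []<∷)
<lex-compare (x ∷ xs) (y ∷ ys) with <-cmp x y
... | tri< x<y _ _ = inj₁ (head< x<y)
... | tri> _ _ y<x = inj₂ (inj₂ (head< y<x))
... | tri≈ _ refl _ with <lex-compare xs ys
...   | inj₁ xs<ys        = inj₁ (tail< xs<ys)
...   | inj₂ (inj₁ refl)  = inj₂ (inj₁ refl)
...   | inj₂ (inj₂ ys<xs) = inj₂ (inj₂ (tail< ys<xs))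

open Ranking _<lex?_ <lex-irrefl <lex-trans <lex-compare

suffixes : List ℕ → List (List ℕ)
suffixes []       = []
suffixes (x ∷ xs) = (x ∷ xs) ∷ suffixes xs

length-suffixes : ∀ S → length (suffixes S) ≡ length S
length-suffixes []       = refl
length-suffixes (x ∷ xs) = cong suc (length-suffixes xs)

suffixes-shorter : ∀ S → All (λ s → length s ≤ length S) (suffixes S)
suffixes-shorter []       = []
suffixes-shorter (x ∷ xs) = ≤-refl ∷ All.map m≤n⇒m≤1+n (suffixes-shorter xs)

suffixes-unique : ∀ S → Unique (suffixes S)
suffixes-unique []       = []
suffixes-unique (x ∷ xs) = All.map longer (suffixes-shorter xs) ∷ suffixes-unique xs
  where
  longer : ∀ {s} → length s ≤ length xs → x ∷ xs ≢ s
  longer s≤n refl = 1+n≰n s≤n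

applyUpTo-drop : ∀ S → applyUpTo (λ i → drop i S) (length S) ≡ suffixes S
applyUpTo-drop []       = refl
applyUpTo-drop (x ∷ xs) = cong ((x ∷ xs) ∷_) (applyUpTo-drop xs)

map-suf-positions : ∀ S → map (suf S) (positions S) ≡ suffixes S
map-suf-positions S = begin
  map (suf S) (map suc (upTo (length S)))  ≡⟨ map-∘ (upTo (length S)) ⟨
  map (suf S ∘ suc) (upTo (length S))      ≡⟨ map-upTo (suf S ∘ suc) (length S) ⟩
  applyUpTo (λ i → drop i S) (length S)    ≡⟨ applyUpTo-drop S ⟩
  suffixes S                               ∎
  where open ≡-Reasoning

rank≡suc-below : ∀ S i → rank S i ≡ suc (below (suf S i) (suffixes S))
rank≡suc-below S i = cong suc (trans (length-filter-map (_<lex? suf S i) (suf S) (positions S))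
                                     (cong (below (suf S i)) (map-suf-positions S)))

private variable
  T : List ℕ
  σ i j k r : ℕ

∈-positions⁺ : ∀ S → 1 ≤ j → j ≤ length S → j ∈ positions S
∈-positions⁺ {suc i} S _ j≤n = ∈-map⁺ suc (∈-upTo⁺ j≤n)

∈-positions⁻ : ∀ S → j ∈ positions S → ∃[ i ] j ≡ suc i × i < length S
∈-positions⁻ S j∈ with i , i∈ , j≡1+i ← ∈-map⁻ suc j∈ = i , j≡1+i , ∈-upTo⁻ i∈

suf-∈-suffixes : ∀ S → j ∈ positions S → suf S j ∈ suffixes S
suf-∈-suffixes {j} S j∈ = subst (suf S j ∈_) (map-suf-positions S) (∈-map⁺ (suf S) j∈)

∈-suffixes⁻ : ∀ S {s} → s ∈ suffixes S → ∃[ k ] k ∈ positions S × s ≡ suf S k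
∈-suffixes⁻ S s∈ = ∈-map⁻ (suf S) (subst (_ ∈_) (sym (map-suf-positions S)) s∈)

suf-injective : ∀ S → i ∈ positions S → k ∈ positions S → suf S i ≡ suf S k → i ≡ k
suf-injective S i∈ k∈ eq
  with i , refl , i<n ← ∈-positions⁻ S i∈ | k , refl , k<n ← ∈-positions⁻ S k∈
  = cong suc (∸-cancelˡ-≡ (<⇒≤ i<n) (<⇒≤ k<n)
      (trans (sym (length-drop i S)) (trans (cong length eq) (length-drop k S))))

suf-≢[] : ∀ S → j ∈ positions S → suf S j ≢ []
suf-≢[] S j∈ eq with i , refl , i<n ← ∈-positions⁻ S j∈ =
  <⇒≢ (m<n⇒0<n∸m i<n) (trans (cong length (sym eq)) (length-drop i S))

rank+above : ∀ S → j ∈ positions S → rank S j + above (suf S j) (suffixes S) ≡ length S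
rank+above {j} S j∈ = begin
  rank S j + above s (suffixes S)                   ≡⟨ cong (_+ above s (suffixes S)) (rank≡suc-below S j) ⟩
  suc (below s (suffixes S) + above s (suffixes S)) ≡⟨ below-+-above (suffixes-unique S) (suf-∈-suffixes S j∈) ⟩
  length (suffixes S)                               ≡⟨ length-suffixes S ⟩
  length S                                          ∎
  where
  open ≡-Reasoning
  s = suf S j

rank≤length : ∀ S → j ∈ positions S → rank S j ≤ length S
rank≤length {j} S j∈ = subst (rank S j ≤_) (rank+above S j∈) (m≤m+n _ _)

rank-injective : ∀ S → i ∈ positions S → k ∈ positions S → rank S i ≡ rank S k → i ≡ k
rank-injective {i} {k} S i∈ k∈ eq =
  suf-injective S i∈ k∈ (below-injective (suf-∈-suffixes S i∈) (suf-∈-suffixes S k∈)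
    (suc-injective (trans (sym (rank≡suc-below S i)) (trans eq (rank≡suc-below S k)))))

rank-surjective : ∀ S → 1 ≤ r → r ≤ length S → ∃[ k ] k ∈ positions S × rank S k ≡ r
rank-surjective {suc r} S _ r<n
  with s , s∈ , s≡r ← below-surjective (suffixes-unique S) (subst (r <_) (sym (length-suffixes S)) r<n)
  with k , k∈ , refl ← ∈-suffixes⁻ S s∈
  = k , k∈ , trans (rank≡suc-below S k) (cong suc s≡r)

rank-predecessor : ∀ S → j ∈ positions S → rank S j ≢ 1 → ∃[ k ] k ∈ positions S × suc (rank S k) ≡ rank S j
-- rank S j unfolds to suc r (r = number of smaller suffixes), and the predecessor has rank r.
rank-predecessor S j∈ rⱼ≢1
  with k , k∈ , rₖ ← rank-surjective S (n≢0⇒n>0 (rⱼ≢1 ∘ cong suc)) (<⇒≤ (rank≤length S j∈))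
  = k , k∈ , cong suc rₖ

rank-successor : ∀ S → j ∈ positions S → rank S j ≢ length S → ∃[ k ] k ∈ positions S × rank S k ≡ suc (rank S j)
rank-successor S j∈ rⱼ≢n = rank-surjective S (s≤s z≤n) (≤∧≢⇒< (rank≤length S j∈) rⱼ≢n)

findRank-sound : ∀ S {xs} → k ∈ xs → rank S k ≡ r → findRank S r xs ∈ xs × rank S (findRank S r xs) ≡ r
findRank-sound {k} {r} S {j ∷ js} k∈ rₖ with rank S j ≟ r
... | yes rⱼ = here refl , rⱼ
... | no rⱼ≢r with k∈
...   | here refl  = contradiction rₖ rⱼ≢r
...   | there k∈js = let (found∈ , r-found) = findRank-sound S k∈js rₖ in there found∈ , r-found

SA-rank : ∀ S → k ∈ positions S → rank S k ≡ r → SA S r ≡ k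
SA-rank S k∈ rₖ = let (found∈ , r-found) = findRank-sound S k∈ rₖ in rank-injective S found∈ k∈ (trans r-found (sym rₖ))

Φ-spec : ∀ S → k ∈ positions S → suc (rank S k) ≡ rank S j → Φ S j ≡ k
Φ-spec {j = j} S k∈ rₖ<rⱼ with rank S j ≟ 1
... | yes rⱼ≡1 = contradiction (suc-injective (trans rₖ<rⱼ rⱼ≡1)) λ ()
... | no _     = SA-rank S k∈ (cong (_∸ 1) rₖ<rⱼ)

Φinv-spec : ∀ S → k ∈ positions S → rank S k ≡ suc (rank S j) → Φinv S j ≡ k
Φinv-spec {j = j} S k∈ rₖ≡1+rⱼ with rank S j ≟ length S
... | yes rⱼ≡n = contradiction (subst (_≤ length S) rₖ≡1+rⱼ (rank≤length S k∈)) (<-irrefl rⱼ≡n)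
... | no _     = SA-rank S k∈ rₖ≡1+rⱼ

block : ℕ → ℕ
block j = 1 + 5 * (j ∸ 1)

length-transform : ∀ σ T → length (transform σ T) ≡ suc (5 * length T)
length-transform σ []      = refl
length-transform σ (c ∷ T) = begin
  5 + length (transform σ T)  ≡⟨ cong (5 +_) (length-transform σ T) ⟩
  5 + suc (5 * length T)      ≡⟨ +-suc 5 _ ⟩
  suc (5 + 5 * length T)      ≡⟨ cong suc (*-suc 5 _) ⟨
  suc (5 * suc (length T))    ∎
  where open ≡-Reasoning

drop-transform : ∀ σ T m → m ≤ length T → drop (5 * m) (transform σ T) ≡ transform σ (drop m T)
drop-transform σ T       zero    _         = refl
drop-transform σ (c ∷ T) (suc m) (s≤s m≤n) =
  trans (cong (λ i → drop i (transform σ (c ∷ T))) (*-suc 5 m)) (drop-transform σ T m m≤n)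

suf-block : ∀ σ T → j ∈ positions T → suf (transform σ T) (block j) ≡ transform σ (suf T j)
suf-block σ T j∈ with i , refl , i<n ← ∈-positions⁻ T j∈ = drop-transform σ T i (<⇒≤ i<n)

block-∈-positions : ∀ σ T → j ∈ positions T → block j ∈ positions (transform σ T)
block-∈-positions σ T j∈ with i , refl , i<n ← ∈-positions⁻ T j∈ =
  ∈-positions⁺ (transform σ T) (s≤s z≤n)
    (subst (suc (5 * i) ≤_) (sym (length-transform σ T)) (s≤s (*-monoʳ-≤ 5 (<⇒≤ i<n))))

transform-reverses : ∀ {U V} → All (_< σ) U → V <lex U → transform σ U <lex transform σ V
transform-reverses _           []<∷        = head< z<s
transform-reverses (u<σ ∷ _)   (head< v<u) =
  tail< (tail< (tail< (head< (∸-monoʳ-< v<u (∸-monoˡ-≤ 1 u<σ)))))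
transform-reverses (_ ∷ U<σ)   (tail< V<U) =
  tail< (tail< (tail< (tail< (tail< (transform-reverses U<σ V<U)))))

transform-reflects : ∀ {U V} → All (_< σ) U → All (_< σ) V →
  transform σ U <lex transform σ V → V <lex U
transform-reflects {U = U} {V} U<σ V<σ TU<TV with <lex-compare V U
... | inj₁ V<U        = V<U
... | inj₂ (inj₁ refl) = contradiction TU<TV <lex-irrefl
... | inj₂ (inj₂ U<V) = contradiction (<lex-trans TU<TV (transform-reverses V<σ U<V)) <lex-irrefl

1∷≮0∷ : ∀ {xs ys} → ¬ (1 ∷ xs) <lex (0 ∷ ys)
1∷≮0∷ (head< ())

n∷1∷≮0∷0∷ : ∀ {n xs ys} → ¬ (n ∷ 1 ∷ xs) <lex (0 ∷ 0 ∷ ys)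
n∷1∷≮0∷0∷ (head< ())
n∷1∷≮0∷0∷ (tail< (head< ()))

below-transform : ∀ {U} → All (_< σ) U → All (_< σ) T → U ≢ [] →
  below (transform σ U) (suffixes (transform σ T)) ≡ above U (suffixes T)
below-transform {U = []}    _   _   U≢[] = contradiction refl U≢[]
below-transform {U = _ ∷ _} _   []  _    = refl
below-transform {σ = σ} {T = c ∷ T} {U = u ∷ U} U<σ cT<σ@(_ ∷ T<σ) U≢[] =
  below-∷≡above-∷ (transform-reflects cT<σ U<σ) (transform-reverses cT<σ) (begin
    below (transform σ (u ∷ U)) (interior ++ suffixes R)  ≡⟨ below-++ {ys = interior} (n∷1∷≮0∷0∷ ∷ 1∷≮0∷ ∷ n∷1∷≮0∷0∷ ∷ 1∷≮0∷ ∷ []) ⟩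
    below (transform σ (u ∷ U)) (suffixes R)              ≡⟨ below-transform U<σ T<σ U≢[] ⟩
    above (u ∷ U) (suffixes T)                            ∎)
  where
  open ≡-Reasoning
  R = transform σ T
  y = σ ∸ 1 ∸ c
  interior : List (List ℕ)
  interior = (0 ∷ 1 ∷ y ∷ 1 ∷ R) ∷ (1 ∷ y ∷ 1 ∷ R) ∷ (y ∷ 1 ∷ R) ∷ (1 ∷ R) ∷ []

rank-block : ∀ σ T → All (_< σ) T → j ∈ positions T →
  rank (transform σ T) (block j) ≡ suc (above (suf T j) (suffixes T))
rank-block {j} σ T T<σ j∈ = begin
  rank T' (block j)                                  ≡⟨ rank≡suc-below T' (block j) ⟩
  suc (below (suf T' (block j)) (suffixes T'))       ≡⟨ cong (λ s → suc (below s (suffixes T'))) (suf-block σ T j∈) ⟩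
  suc (below (transform σ (suf T j)) (suffixes T'))  ≡⟨ cong suc (below-transform (drop⁺ (j ∸ 1) T<σ) T<σ (suf-≢[] T j∈)) ⟩
  suc (above (suf T j) (suffixes T))                 ∎
  where
  open ≡-Reasoning
  T' = transform σ T

block-rank-step : ∀ σ T → All (_< σ) T → j ∈ positions T → k ∈ positions T →
  suc (rank T k) ≡ rank T j → rank (transform σ T) (block k) ≡ suc (rank (transform σ T) (block j))
block-rank-step {j} {k} σ T T<σ j∈ k∈ rₖ<rⱼ = begin
  rank T' (block k)                        ≡⟨ rank-block σ T T<σ k∈ ⟩
  suc (above (suf T k) (suffixes T))       ≡⟨ cong suc aboveₖ≡1+aboveⱼ ⟩
  suc (suc (above (suf T j) (suffixes T))) ≡⟨ cong suc (rank-block σ T T<σ j∈) ⟨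
  suc (rank T' (block j))                  ∎
  where
  open ≡-Reasoning
  T' = transform σ T
  aboveₖ≡1+aboveⱼ : above (suf T k) (suffixes T) ≡ suc (above (suf T j) (suffixes T))
  aboveₖ≡1+aboveⱼ = +-cancelˡ-≡ (rank T k) _ _ (begin
    rank T k + above (suf T k) (suffixes T)        ≡⟨ rank+above T k∈ ⟩
    length T                                       ≡⟨ rank+above T j∈ ⟨
    rank T j + above (suf T j) (suffixes T)        ≡⟨ cong (_+ above (suf T j) (suffixes T)) rₖ<rⱼ ⟨
    suc (rank T k) + above (suf T j) (suffixes T)  ≡⟨ +-suc (rank T k) _ ⟨
    rank T k + suc (above (suf T j) (suffixes T))  ∎)

mainTheorem14 : (σ : ℕ) → 1 ≤ σ → (T : List ℕ) → All (_< σ) T → 1 ≤ length T →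
    ((j : ℕ) → 1 ≤ j → j ≤ length T → j ≢ SA T 1 →
      Φinv (transform σ T) (1 + 5 * (j ∸ 1)) ≡ 5 * (Φ T j ∸ 1) + 1)
    × ((j : ℕ) → 1 ≤ j → j ≤ length T → j ≢ SA T (length T) →
      Φ (transform σ T) (1 + 5 * (j ∸ 1)) ≡ 5 * (Φinv T j ∸ 1) + 1)
mainTheorem14 σ _ T T<σ _ = Φinv-block , Φ-block
  where
  open ≡-Reasoning
  T' = transform σ T

  Φinv-block : (j : ℕ) → 1 ≤ j → j ≤ length T → j ≢ SA T 1 → Φinv T' (block j) ≡ 5 * (Φ T j ∸ 1) + 1
  Φinv-block j 1≤j j≤n j≢SA₁
    with j∈ ← ∈-positions⁺ T 1≤j j≤n
    with k , k∈ , rₖ<rⱼ ← rank-predecessor T j∈ (j≢SA₁ ∘ sym ∘ SA-rank T j∈) = begin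
    Φinv T' (block j)    ≡⟨ Φinv-spec T' (block-∈-positions σ T k∈) (block-rank-step σ T T<σ j∈ k∈ rₖ<rⱼ) ⟩
    block k              ≡⟨ +-comm 1 _ ⟩
    5 * (k ∸ 1) + 1      ≡⟨ cong (λ i → 5 * (i ∸ 1) + 1) (Φ-spec T k∈ rₖ<rⱼ) ⟨
    5 * (Φ T j ∸ 1) + 1  ∎

  Φ-block : (j : ℕ) → 1 ≤ j → j ≤ length T → j ≢ SA T (length T) → Φ T' (block j) ≡ 5 * (Φinv T j ∸ 1) + 1
  Φ-block j 1≤j j≤n j≢SAₙ
    with j∈ ← ∈-positions⁺ T 1≤j j≤n
    with k , k∈ , rₖ≡1+rⱼ ← rank-successor T j∈ (j≢SAₙ ∘ sym ∘ SA-rank T j∈) = begin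
    Φ T' (block j)          ≡⟨ Φ-spec T' (block-∈-positions σ T k∈) (sym (block-rank-step σ T T<σ k∈ j∈ (sym rₖ≡1+rⱼ))) ⟩
    block k                 ≡⟨ +-comm 1 _ ⟩
    5 * (k ∸ 1) + 1         ≡⟨ cong (λ i → 5 * (i ∸ 1) + 1) (Φinv-spec T k∈ rₖ≡1+rⱼ) ⟨
    5 * (Φinv T j ∸ 1) + 1  ∎
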